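{- Suppose that a $\mathsf{PHHF}(2;\kappa,(w_1,w_2),2)$ exists and $n\ge 6$. Then: (i) for every integer $k\ge 1$, a $\mathsf{PHHF}(n;6\kappa+(n-6)k,(4\kappa+(n-6)k+w_1+w_2)^6(6\kappa+(n-7)k+1)^{n-6},2n-3)$ exists; (ii) if $w_1+w_2\le 2\kappa$, a $\mathsf{PHF}(n;(2n-6)\kappa-(n-6)(w_1+w_2-1),(2n-8)\kappa-(n-7)(w_1+w_2-1)+1,2n-3)$ exists.
   Context: An $\mathsf{HHF}(N;k,(w_1,\dots,w_N))$ is an $N\times k$ array in which row $i$ contains at most $w_i$ distinct symbols. A $\mathsf{PHHF}(N;k,(w_1,\dots,w_N),t)$ is an $\mathsf{HHF}(N;k,(w_1,\dots,w_N))$ such that for every set of $t$ columns there is a row in which the entries in these $t$ columns are pairwise distinct; when all $w_i=w$ it is written $\mathsf{PHF}(N;k,w,t)$. Exponential notation $x_1^{u_1}\cdots x_c^{u_c}$ for the symbol-count vector means the $\sum u_i$ rows can be partitioned into classes, the $i$th class consisting of $u_i$ rows each containing at most $x_i$ symbols. -}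

module Defs where

open import Data.Nat using (ℕ; _<ᵇ_)
open import Data.Integer as ℤ using (ℤ; +_)
open import Data.Fin using (Fin; toℕ)
open import Data.List using (List; length)
open import Data.List.Membership.Propositional using (_∈_)
open import Data.Product using (Σ; _×_; ∃)
open import Data.Bool using (if_then_else_)
open import Function.Definitions using (Injective)
open import Relation.Binary.PropositionalEquality using (_≡_)

Array : ℕ → ℕ → Set
Array N k = Fin N → Fin k → ℕ

-- Weights are integers so that the
-- formulas of the paper (which may involve negative intermediate values)
-- can be used verbatim; a negative weight is unsatisfiable.
RowAtMost : {N k : ℕ} → Array N k → Fin N → ℤ → Set
RowAtMost {N} {k} A i w =
  Σ (List ℕ) λ S → (ℤ.+ length S ℤ.≤ w) × ((j : Fin k) → A i j ∈ S)

IsHHF : (N k : ℕ) → (Fin N → ℤ) → Array N k → Set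
IsHHF N k w A = (i : Fin N) → RowAtMost A i (w i)

IsPerfect : (N k t : ℕ) → Array N k → Set
IsPerfect N k t A =
  (c : Fin t → Fin k) → Injective _≡_ _≡_ c →
  ∃ λ (i : Fin N) → Injective _≡_ _≡_ (λ a → A i (c a))

PHHF : (N k : ℕ) → (Fin N → ℤ) → (t : ℕ) → Set
PHHF N k w t = Σ (Array N k) λ A → IsHHF N k w A × IsPerfect N k t A

PHF : (N k : ℕ) → ℤ → (t : ℕ) → Set
PHF N k v t = PHHF N k (λ _ → v) t

-- the symbol-count vector x^u y^(N-u): the first u rows get x, the rest y
-- (the order of rows is irrelevant for the PHHF property)
expo2 : {N : ℕ} → (x : ℤ) → (u : ℕ) → (y : ℤ) → Fin N → ℤ
expo2 x u y i = if toℕ i <ᵇ u then x else y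

pair : ℤ → ℤ → Fin 2 → ℤ
pair a b Fin.zero = a
pair a b (Fin.suc _) = b

-- The columns are six copies (groups 0–5) of the κ columns of the given PHHF(2; κ, (w₁, w₂), 2)
-- together with n − 6 extra groups of k columns.  Top row r reads group r through the first base
-- row and group (partner r) through the second, and gives the other four groups and all extra
-- columns private symbols; extra row j gives private symbols everywhere, except that extra group j
-- collapses to a single symbol.  If no row separated 2n − 3 chosen columns, each extra row would
-- force two chosen columns into its group, and each of the triples {0,1,2}, {3,4,5} would contain
-- five: the three top rows of a triple force clashes in its groups, and two clashes in one group
-- come from different base rows, so, since the base rows separate, they involve three columns.
-- That gives 10 + 2(n − 6) > 2n − 3 chosen columns.  For (ii), k = 2κ − w₁ − w₂ + 1 makes the
-- weights of top and extra rows equal.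

module Submission where

open import Defs
open import Data.Nat as ℕ using (ℕ; zero; suc; _≤_; _<_; _∸_; _+_; _*_; z≤n; s≤s)
import Data.Nat.Properties as ℕ
import Data.Integer.Properties as ℤ
open import Data.Integer as ℤ using (ℤ; +_; +≤+)
open import Data.Fin using (Fin; zero; suc; toℕ; splitAt; punchOut; inject≤; #_)
open import Data.Fin.Properties
  using (_≟_; 0≢1+n; suc-injective; toℕ-injective; inject≤-injective; punchOut-injective;
         injective⇒≤; any?; all?; +↔⊎; *↔×; 1↔⊤)
open import Data.List using (map; allFin; length)
open import Data.List.Properties using (length-map; length-tabulate)
open import Data.List.Membership.Propositional.Properties using (∈-map⁺; ∈-allFin)
open import Data.List.Membership.Setoid.Properties using (index-injective)
import Data.List.Relation.Unary.Any as Any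
open import Data.Product using (Σ; _×_; ∃; ∃₂; _,_; proj₁; proj₂)
open import Data.Sum using (_⊎_; inj₁; inj₂; [_,_])
open import Data.Sum.Properties using (inj₁-injective; inj₂-injective; [,]-map)
open import Data.Product.Properties using (,-injectiveˡ; ,-injectiveʳ)
open import Data.Unit using (⊤; tt)
open import Data.Bool using (true; false)
open import Data.Empty using (⊥; ⊥-elim)
open import Function using (_∘_; id; const)
open import Function.Bundles using (Injection; _↣_; _↔_; Inverse)
open import Function.Construct.Composition using (_↣-∘_)
open import Function.Construct.Identity using (↣-id)
open import Function.Properties.Inverse using (↔⇒↣; ↔-sym)
open import Data.Sum.Function.Propositional using (_⊎-↣_)
open import Data.Product.Function.NonDependent.Propositional using (_×-↣_)
open import Function.Definitions using (Injective)
open import Relation.Nullary using (¬_; Dec; yes; no; ¬?; _×-dec_)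
open import Relation.Nullary.Decidable using (decidable-stable; map′; toWitness; _→-dec_)
open import Relation.Binary.Definitions using (DecidableEquality)
open import Data.Vec using (Vec; []; _∷_; lookup)
open import Level using (0ℓ)
open import Relation.Unary using (Pred; _⊆_; _∪_; _∩_; ∅)
open import Relation.Binary.PropositionalEquality hiding ([_])
import Data.Nat.Tactic.RingSolver as ℕ-Solver
import Data.Integer.Tactic.RingSolver as ℤ-Solver

-- Counting distinct indices

record AtLeast {t} (s : ℕ) (P : Pred (Fin t) 0ℓ) : Set where
  constructor distinct
  field
    pick : Fin s → Fin t
    pick-injective : Injective _≡_ _≡_ pick
    pick-satisfies : ∀ i → P (pick i)

private
  variable
    t s s′ : ℕ
    P Q : Pred (Fin t) 0ℓ

AtLeast⇒≤ : {P : Pred (Fin t) 0ℓ} → AtLeast s P → s ≤ t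
AtLeast⇒≤ (distinct f f-inj _) = injective⇒≤ f-inj

AtLeast-≤ : s ≤ s′ → AtLeast s′ P → AtLeast s P
AtLeast-≤ s≤s′ (distinct f f-inj fP) =
  distinct (f ∘ embed) (λ e → inject≤-injective s≤s′ s≤s′ _ _ (f-inj e)) (fP ∘ embed)
  where
  embed : Fin _ → Fin _
  embed i = inject≤ i s≤s′

AtLeast-mono : P ⊆ Q → AtLeast s P → AtLeast s Q
AtLeast-mono P⊆Q (distinct f f-inj fP) = distinct f f-inj (P⊆Q ∘ fP)

AtLeast-zero : AtLeast 0 P
AtLeast-zero = distinct (λ ()) (λ {}) (λ ())

AtLeast-cons : ∀ {p} → P p → AtLeast s (λ q → P q × q ≢ p) → AtLeast (suc s) P
AtLeast-cons {P = P} {s = s} {p = p} Pp (distinct f f-inj fP) = distinct g g-inj gP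
  where
  g : Fin (suc s) → Fin _
  g zero = p
  g (suc i) = f i
  g-inj : Injective _≡_ _≡_ g
  g-inj {zero} {zero} _ = refl
  g-inj {zero} {suc j} p≡fj = ⊥-elim (proj₂ (fP j) (sym p≡fj))
  g-inj {suc i} {zero} fi≡p = ⊥-elim (proj₂ (fP i) fi≡p)
  g-inj {suc i} {suc j} fi≡fj = cong suc (f-inj fi≡fj)
  gP : ∀ i → P (g i)
  gP zero = Pp
  gP (suc i) = proj₁ (fP i)

AtLeast-pair : ∀ {p q} → p ≢ q → P p → P q → AtLeast 2 P
AtLeast-pair p≢q Pp Pq = AtLeast-cons Pp (AtLeast-cons (Pq , p≢q ∘ sym) AtLeast-zero)

AtLeast-triple : ∀ {p q r} → p ≢ q → p ≢ r → q ≢ r → P p → P q → P r → AtLeast 3 P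
AtLeast-triple p≢q p≢r q≢r Pp Pq Pr =
  AtLeast-cons Pp (AtLeast-cons (Pq , p≢q ∘ sym)
    (AtLeast-cons ((Pr , p≢r ∘ sym) , q≢r ∘ sym) AtLeast-zero))

AtLeast-two-pairs : ∀ {p q p′ q′} → p ≢ q → p′ ≢ q′ →
  ¬ (p′ ≡ p × q′ ≡ q) → ¬ (p′ ≡ q × q′ ≡ p) →
  P p → P q → P p′ → P q′ → AtLeast 3 P
AtLeast-two-pairs {p = p} {q} {p′} {q′} p≢q p′≢q′ same swapped Pp Pq Pp′ Pq′
  with p′ ≟ p | p′ ≟ q
... | no p′≢p | no p′≢q = AtLeast-triple p≢q (p′≢p ∘ sym) (p′≢q ∘ sym) Pp Pq Pp′
... | yes refl | _ with q′ ≟ q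
...   | yes refl = ⊥-elim (same (refl , refl))
...   | no q′≢q = AtLeast-triple p≢q p′≢q′ (q′≢q ∘ sym) Pp Pq Pq′
AtLeast-two-pairs {p = p} {q} {p′} {q′} p≢q p′≢q′ same swapped Pp Pq Pp′ Pq′
    | no _ | yes refl with q′ ≟ p
...   | yes refl = ⊥-elim (swapped (refl , refl))
...   | no q′≢p = AtLeast-triple p≢q (q′≢p ∘ sym) p′≢q′ Pp Pq Pq′

AtLeast-∪ : P ∩ Q ⊆ ∅ → AtLeast s P → AtLeast s′ Q → AtLeast (s + s′) (P ∪ Q)
AtLeast-∪ {P = P} {Q = Q} {s = s} {s′} disjoint (distinct f f-inj fP) (distinct g g-inj gQ) =
  distinct (h ∘ splitAt s) (λ e → splitAt-injective (h-inj e)) (hPQ ∘ splitAt s)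
  where
  h : Fin s ⊎ Fin s′ → Fin _
  h = [ f , g ]
  h-inj : Injective _≡_ _≡_ h
  h-inj {inj₁ i} {inj₁ j} e = cong inj₁ (f-inj e)
  h-inj {inj₁ i} {inj₂ j} e = ⊥-elim (disjoint (fP i , subst Q (sym e) (gQ j)))
  h-inj {inj₂ i} {inj₁ j} e = ⊥-elim (disjoint (fP j , subst Q e (gQ i)))
  h-inj {inj₂ i} {inj₂ j} e = cong inj₂ (g-inj e)
  hPQ : ∀ u → (P ∪ Q) (h u)
  hPQ (inj₁ i) = inj₁ (fP i)
  hPQ (inj₂ j) = inj₂ (gQ j)
  splitAt-injective : Injective _≡_ _≡_ (splitAt s {s′})
  splitAt-injective = Injection.injective (↔⇒↣ +↔⊎)

AtLeast-⋃ : ∀ m (Q : Fin m → Pred (Fin t) 0ℓ) →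
  (∀ {j j′ p} → Q j p → Q j′ p → j ≡ j′) →
  (∀ j → AtLeast s (Q j)) → AtLeast (m * s) (λ p → ∃ λ j → Q j p)
AtLeast-⋃ zero Q disjoint _ = AtLeast-zero
AtLeast-⋃ (suc m) Q disjoint each =
  AtLeast-mono (λ { (inj₁ q) → zero , q ; (inj₂ (j , q)) → suc j , q })
    (AtLeast-∪ (λ (q₀ , _ , q) → 0≢1+n (disjoint q₀ q))
      (each zero)
      (AtLeast-⋃ m (Q ∘ suc) (λ q q′ → suc-injective (disjoint q q′)) (each ∘ suc)))

-- Arrays built from encoded symbols

Collision : {A : Set} → (Fin t → A) → Set
Collision f = ∃₂ λ p q → p ≢ q × f p ≡ f q

collision? : (f : Fin t → ℕ) → Dec (Collision f)
collision? f = any? λ p → any? λ q → ¬? (p ≟ q) ×-dec (f p ℕ.≟ f q)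

¬collision⇒injective : {f : Fin t → ℕ} → ¬ Collision f → Injective _≡_ _≡_ f
¬collision⇒injective none {p} {q} fp≡fq = decidable-stable (p ≟ q) λ p≢q → none (p , q , p≢q , fp≡fq)

Collision-cancelˡ : {A B : Set} {g : A → B} {f : Fin t → A} →
  Injective _≡_ _≡_ g → Collision (g ∘ f) → Collision f
Collision-cancelˡ g-inj (p , q , p≢q , e) = p , q , p≢q , g-inj e

module Realisation {N K : ℕ} {Row Col : Set}
  (rows : Fin N ↔ Row) (columns : Fin K ↣ Col)
  (Symbol : Row → Set) (size : Row → ℕ) (encode : ∀ r → Symbol r ↣ Fin (size r))
  (entry : ∀ r → Col → Symbol r) where

  open Inverse rows using (from; strictlyInverseˡ) renaming (to to row)
  open Injection columns using () renaming (to to column; injective to column-injective)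

  symbol : ∀ r → Col → ℕ
  symbol r c = toℕ (Injection.to (encode r) (entry r c))

  array : Array N K
  array i j = symbol (row i) (column j)

  array-rowAtMost : ∀ i {w} → + size (row i) ℤ.≤ w → RowAtMost array i w
  array-rowAtMost i {w} size≤w =
    map toℕ (allFin M) ,
    subst (λ l → + l ℤ.≤ w)
      (sym (trans (length-map toℕ (allFin M)) (length-tabulate {n = M} id))) size≤w ,
    λ j → ∈-map⁺ toℕ (∈-allFin _)
    where M = size (row i)

  symbol-collision : ∀ r {d : Fin t → Col} → Collision (symbol r ∘ d) → Collision (entry r ∘ d)
  symbol-collision r = Collision-cancelˡ (Injection.injective (encode r) ∘ toℕ-injective)

  array-perfect : (∀ (d : Fin t → Col) → Injective _≡_ _≡_ d → ¬ (∀ r → Collision (entry r ∘ d))) →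
    IsPerfect N K t array
  array-perfect every-row-collides c c-inj with any? (λ i → ¬? (collision? (array i ∘ c)))
  ... | yes (i , ¬collision) = i , ¬collision⇒injective ¬collision
  ... | no none = ⊥-elim (every-row-collides (column ∘ c) (c-inj ∘ column-injective) λ r →
    symbol-collision r (subst (λ r′ → Collision (symbol r′ ∘ column ∘ c)) (strictlyInverseˡ r)
      (decidable-stable (collision? _) λ ¬collision → none (from r , ¬collision))))

infixr 4 _⊎ᶠ_
infixr 5 _×ᶠ_

_⊎ᶠ_ : {A B : Set} {a b : ℕ} → A ↣ Fin a → B ↣ Fin b → (A ⊎ B) ↣ Fin (a + b)
f ⊎ᶠ g = ↔⇒↣ (↔-sym +↔⊎) ↣-∘ (f ⊎-↣ g)

_×ᶠ_ : {A B : Set} {a b : ℕ} → A ↣ Fin a → B ↣ Fin b → (A × B) ↣ Fin (a * b)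
f ×ᶠ g = ↔⇒↣ (↔-sym *↔×) ↣-∘ (f ×-↣ g)

-- Base PHHFs and symbol-count vectors

rowAtMost⇒fin : ∀ {N k} (A : Array N k) i {w} → RowAtMost A i (+ w) →
  ∃ λ L → L ≤ w × Σ (Fin k → Fin L) λ g → ∀ {x y} → g x ≡ g y → A i x ≡ A i y
rowAtMost⇒fin A i (S , +≤+ |S|≤w , A∈S) =
  length S , |S|≤w , Any.index ∘ A∈S , λ {x} {y} → index-injective (setoid ℕ) (A∈S x) (A∈S y)

record TwoRowCode (κ w₁ w₂ : ℕ) : Set where
  field
    L₁ L₂ : ℕ
    L₁≤w₁ : L₁ ≤ w₁
    L₂≤w₂ : L₂ ≤ w₂
    row₁ : Fin κ → Fin L₁
    row₂ : Fin κ → Fin L₂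
    separating : ∀ {x y} → row₁ x ≡ row₁ y → row₂ x ≡ row₂ y → x ≡ y

phhf⇒twoRowCode : ∀ {κ w₁ w₂} → PHHF 2 κ (pair (+ w₁) (+ w₂)) 2 → TwoRowCode κ w₁ w₂
phhf⇒twoRowCode (A , hhf , perfect)
  with rowAtMost⇒fin A zero (hhf zero) | rowAtMost⇒fin A (suc zero) (hhf (suc zero))
... | L₁ , L₁≤w₁ , row₁ , agree₁ | L₂ , L₂≤w₂ , row₂ , agree₂ =
  record { L₁≤w₁ = L₁≤w₁ ; L₂≤w₂ = L₂≤w₂ ; row₁ = row₁ ; row₂ = row₂ ; separating = separating }
  where
  separating : ∀ {x y} → row₁ x ≡ row₁ y → row₂ x ≡ row₂ y → x ≡ y
  separating {x} {y} e₁ e₂ = decidable-stable (x ≟ y) λ x≢y →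
    let pair = AtLeast-pair {P = λ _ → ⊤} x≢y tt tt
        i , separates = perfect (AtLeast.pick pair) (AtLeast.pick-injective pair)
    in 0≢1+n (separates {zero} {suc zero} (agrees i))
    where
    agrees : ∀ i → A i x ≡ A i y
    agrees zero = agree₁ e₁
    agrees (suc zero) = agree₂ e₂

RowAtMost-weaken : ∀ {N k} {A : Array N k} {i w w′} → w ℤ.≤ w′ → RowAtMost A i w → RowAtMost A i w′
RowAtMost-weaken w≤w′ (S , |S|≤w , A∈S) = S , ℤ.≤-trans |S|≤w w≤w′ , A∈S

PHHF-weaken : ∀ {N K t} {w w′ : Fin N → ℤ} → (∀ i → w i ℤ.≤ w′ i) → PHHF N K w t → PHHF N K w′ t
PHHF-weaken w≤w′ (A , hhf , perfect) =
  A , (λ i → RowAtMost-weaken {A = A} {i} (w≤w′ i) (hhf i)) , perfect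

expo2-≤ : ∀ {N u} {x y w : ℤ} → x ℤ.≤ w → y ℤ.≤ w → (i : Fin N) → expo2 x u y i ℤ.≤ w
expo2-≤ {u = u} x≤w y≤w i with toℕ i ℕ.<ᵇ u
... | true = x≤w
... | false = y≤w

expo2-splitAt : ∀ u {m} {x y : ℤ} (i : Fin (u + m)) →
  expo2 x u y i ≡ [ const x , const y ] (splitAt u i)
expo2-splitAt zero i = refl
expo2-splitAt (suc u) zero = refl
expo2-splitAt (suc u) (suc i) = trans (expo2-splitAt u i) (sym ([,]-map (splitAt u i)))

-- The construction

collapse : ∀ {m} {A : Set} → (j b : Fin m) → A → (Fin (ℕ.pred m) × A) ⊎ ⊤
collapse {suc m} j b y with b ≟ j
... | yes _ = inj₂ tt
... | no b≢j = inj₁ (punchOut (b≢j ∘ sym) , y)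

collapse-collision : ∀ {m} {A : Set} {j b b′ : Fin m} {y y′ : A} →
  collapse j b y ≡ collapse j b′ y′ → (b ≡ j × b′ ≡ j) ⊎ (b , y) ≡ (b′ , y′)
collapse-collision {suc m} {j = j} {b} {b′} e with b ≟ j | b′ ≟ j
... | yes b≡j | yes b′≡j = inj₁ (b≡j , b′≡j)
... | no b≢j | no b′≢j =
  inj₂ (cong₂ _,_ (punchOut-injective (b≢j ∘ sym) (b′≢j ∘ sym) (,-injectiveˡ (inj₁-injective e)))
                  (,-injectiveʳ (inj₁-injective e)))
collapse-collision {suc m} () | yes _ | no _
collapse-collision {suc m} () | no _ | yes _

data Role : Set where
  first second : Role
  fresh : Fin 4 → Role

fresh-injective : ∀ {i j} → fresh i ≡ fresh j → i ≡ j
fresh-injective refl = refl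

_≟ʳ_ : DecidableEquality Role
first ≟ʳ first = yes refl
first ≟ʳ second = no λ ()
first ≟ʳ fresh _ = no λ ()
second ≟ʳ first = no λ ()
second ≟ʳ second = yes refl
second ≟ʳ fresh _ = no λ ()
fresh _ ≟ʳ first = no λ ()
fresh _ ≟ʳ second = no λ ()
fresh i ≟ʳ fresh j = map′ (cong fresh) fresh-injective (i ≟ j)

roleTable : Vec (Vec Role 6) 6
roleTable =
  (first ∷ fresh (# 0) ∷ second ∷ fresh (# 1) ∷ fresh (# 2) ∷ fresh (# 3) ∷ []) ∷
  (second ∷ first ∷ fresh (# 0) ∷ fresh (# 1) ∷ fresh (# 2) ∷ fresh (# 3) ∷ []) ∷
  (fresh (# 0) ∷ second ∷ first ∷ fresh (# 1) ∷ fresh (# 2) ∷ fresh (# 3) ∷ []) ∷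
  (fresh (# 0) ∷ fresh (# 1) ∷ fresh (# 2) ∷ first ∷ fresh (# 3) ∷ second ∷ []) ∷
  (fresh (# 0) ∷ fresh (# 1) ∷ fresh (# 2) ∷ second ∷ first ∷ fresh (# 3) ∷ []) ∷
  (fresh (# 0) ∷ fresh (# 1) ∷ fresh (# 2) ∷ fresh (# 3) ∷ second ∷ first ∷ []) ∷ []

role : Fin 6 → Fin 6 → Role
role r a = lookup (lookup roleTable r) a

partner : Fin 6 → Fin 6
partner = lookup (# 2 ∷ # 0 ∷ # 1 ∷ # 5 ∷ # 3 ∷ # 4 ∷ [])

triple : Fin 6 → Fin 2
triple = lookup (# 0 ∷ # 0 ∷ # 0 ∷ # 1 ∷ # 1 ∷ # 1 ∷ [])

role-injective : ∀ r {a a′} → role r a ≡ role r a′ → a ≡ a′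
role-injective r {a} {a′} = toWitness {a? = all? λ r → all? λ a → all? λ a′ →
  (role r a ≟ʳ role r a′) →-dec (a ≟ a′)} tt r a a′

role-first : ∀ r {a} → role r a ≡ first → a ≡ r
role-first r {a} = toWitness {a? = all? λ r → all? λ a → (role r a ≟ʳ first) →-dec (a ≟ r)} tt r a

role-second : ∀ r {a} → role r a ≡ second → a ≡ partner r
role-second r {a} =
  toWitness {a? = all? λ r → all? λ a → (role r a ≟ʳ second) →-dec (a ≟ partner r)} tt r a

bottom-size≡ : ∀ κ k {m} → Fin m →
  + (6 * κ + (ℕ.pred m * k + 1)) ≡ + (6 * κ) ℤ.+ (+ (6 + m) ℤ.- + 7) ℤ.* + k ℤ.+ + 1
bottom-size≡ κ k {suc m} _ =
  trans (cong +_ (sym (ℕ.+-assoc (6 * κ) (m * k) 1)))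
        (cong (λ z → + (6 * κ) ℤ.+ z ℤ.+ + 1) (ℤ.pos-* m k))

2[6+m]∸3<10+m*2 : ∀ m → 2 * (6 + m) ∸ 3 < 10 + m * 2
2[6+m]∸3<10+m*2 m = ℕ.≤-reflexive (identity m)
  where
  identity : ∀ m → 4 + (m + (6 + (m + 0))) ≡ 10 + m * 2
  identity = ℕ-Solver.solve-∀

pattern copy a x = inj₁ (a , x)
pattern extra b y = inj₂ (b , y)

module Construction {κ w₁ w₂ : ℕ} (code : TwoRowCode κ w₁ w₂) (k m : ℕ) where
  open TwoRowCode code

  Col : Set
  Col = (Fin 6 × Fin κ) ⊎ (Fin m × Fin k)

  data InCopy (a : Fin 6) : Col → Set where
    inCopy : ∀ x → InCopy a (copy a x)

  data InExtra (j : Fin m) : Col → Set where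
    inExtra : ∀ y → InExtra j (extra j y)

  data Agree {L} (h : Fin κ → Fin L) (a : Fin 6) : Col → Col → Set where
    agree : ∀ {x x′} → h x ≡ h x′ → Agree h a (copy a x) (copy a x′)

  InCopy-unique : ∀ {a b c} → InCopy a c → InCopy b c → a ≡ b
  InCopy-unique (inCopy x) (inCopy .x) = refl

  InExtra-unique : ∀ {i j c} → InExtra i c → InExtra j c → i ≡ j
  InExtra-unique (inExtra y) (inExtra .y) = refl

  InCopy∩InExtra : ∀ {a j c} → InCopy a c → InExtra j c → ⊥
  InCopy∩InExtra (inCopy x) ()

  Agree-sym : ∀ {L} {h : Fin κ → Fin L} {a c c′} → Agree h a c c′ → Agree h a c′ c
  Agree-sym (agree e) = agree (sym e)

  Agree⇒InCopy : ∀ {L} {h : Fin κ → Fin L} {a c c′} → Agree h a c c′ → InCopy a c × InCopy a c′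
  Agree⇒InCopy (agree {x} {x′} _) = inCopy x , inCopy x′

  Agree-both : ∀ {a c c′} → Agree row₁ a c c′ → Agree row₂ a c c′ → c ≡ c′
  Agree-both (agree e₁) (agree e₂) = cong (copy _) (separating e₁ e₂)

  Top : Set
  Top = (((Fin 4 × Fin κ) ⊎ (Fin m × Fin k)) ⊎ Fin L₁) ⊎ Fin L₂

  pattern freshSymbol j x = inj₁ (inj₁ (inj₁ (j , x)))
  pattern ownSymbol b y = inj₁ (inj₁ (inj₂ (b , y)))
  pattern base₁ s = inj₁ (inj₂ s)
  pattern base₂ s = inj₂ s

  roleSymbol : Role → Fin κ → Top
  roleSymbol first x = base₁ (row₁ x)
  roleSymbol second x = base₂ (row₂ x)
  roleSymbol (fresh j) x = freshSymbol j x

  topEntry : Fin 6 → Col → Top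
  topEntry r (copy a x) = roleSymbol (role r a) x
  topEntry r (extra b y) = ownSymbol b y

  Related : Role → Fin κ → Fin κ → Set
  Related first x x′ = row₁ x ≡ row₁ x′
  Related second x x′ = row₂ x ≡ row₂ x′
  Related (fresh _) x x′ = x ≡ x′

  roleSymbol-injective : ∀ ρ ρ′ {x x′} → roleSymbol ρ x ≡ roleSymbol ρ′ x′ → ρ ≡ ρ′ × Related ρ x x′
  roleSymbol-injective first first e = refl , inj₂-injective (inj₁-injective e)
  roleSymbol-injective second second e = refl , inj₂-injective e
  roleSymbol-injective (fresh j) (fresh .j) refl = refl , refl
  roleSymbol-injective first second ()
  roleSymbol-injective first (fresh _) ()
  roleSymbol-injective second first ()
  roleSymbol-injective second (fresh _) ()
  roleSymbol-injective (fresh _) first ()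
  roleSymbol-injective (fresh _) second ()

  roleSymbol≢ownSymbol : ∀ ρ {x b y} → roleSymbol ρ x ≢ ownSymbol b y
  roleSymbol≢ownSymbol first ()
  roleSymbol≢ownSymbol second ()
  roleSymbol≢ownSymbol (fresh _) ()

  TopCollision : Fin 6 → Col → Col → Set
  TopCollision r c c′ = c ≡ c′ ⊎ Agree row₁ r c c′ ⊎ Agree row₂ (partner r) c c′

  copy-collision : ∀ r {a x x′} → Related (role r a) x x′ → TopCollision r (copy a x) (copy a x′)
  copy-collision r {a} related with role r a in ρ
  ... | first with refl ← role-first r ρ = inj₂ (inj₁ (agree related))
  ... | second with refl ← role-second r ρ = inj₂ (inj₂ (agree related))
  ... | fresh _ = inj₁ (cong (copy a) related)

  topEntry-collision : ∀ r {c c′} → topEntry r c ≡ topEntry r c′ → TopCollision r c c′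
  topEntry-collision r {copy a x} {copy a′ x′} e
    with ρ≡ρ′ , related ← roleSymbol-injective (role r a) (role r a′) e
    with refl ← role-injective r ρ≡ρ′ = copy-collision r related
  topEntry-collision r {copy a x} {extra _ _} e = ⊥-elim (roleSymbol≢ownSymbol (role r a) e)
  topEntry-collision r {extra _ _} {copy a x} e = ⊥-elim (roleSymbol≢ownSymbol (role r a) (sym e))
  topEntry-collision r {extra _ _} {extra _ _} refl = inj₁ refl

  Bottom : Set
  Bottom = (Fin 6 × Fin κ) ⊎ ((Fin (ℕ.pred m) × Fin k) ⊎ ⊤)

  bottomEntry : Fin m → Col → Bottom
  bottomEntry j (copy a x) = inj₁ (a , x)
  bottomEntry j (extra b y) = inj₂ (collapse j b y)

  bottomEntry-collision : ∀ j {c c′} → bottomEntry j c ≡ bottomEntry j c′ →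
    c ≡ c′ ⊎ InExtra j c × InExtra j c′
  bottomEntry-collision j {copy _ _} {copy _ _} refl = inj₁ refl
  bottomEntry-collision j {extra b y} {extra b′ y′} e with collapse-collision {j = j} (inj₂-injective e)
  ... | inj₁ (refl , refl) = inj₂ (inExtra y , inExtra y′)
  ... | inj₂ refl = inj₁ refl

  Row : Set
  Row = Fin 6 ⊎ Fin m

  Symbol : Row → Set
  Symbol (inj₁ _) = Top
  Symbol (inj₂ _) = Bottom

  entry : ∀ r → Col → Symbol r
  entry (inj₁ r) = topEntry r
  entry (inj₂ j) = bottomEntry j

  module Analysis {t : ℕ} (d : Fin t → Col) (d-injective : Injective _≡_ _≡_ d) where

    Copies : Fin 6 → Pred (Fin t) 0ℓ
    Copies a p = InCopy a (d p)

    Extras : Fin m → Pred (Fin t) 0ℓ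
    Extras j p = InExtra j (d p)

    InTriple : Fin 2 → Pred (Fin t) 0ℓ
    InTriple τ p = ∃ λ a → triple a ≡ τ × Copies a p

    Clash : ∀ {L} → (Fin κ → Fin L) → Fin 6 → Set
    Clash h a = ∃₂ λ p q → p ≢ q × Agree h a (d p) (d q)

    topEntry-clash : ∀ r → Collision (topEntry r ∘ d) → Clash row₁ r ⊎ Clash row₂ (partner r)
    topEntry-clash r (p , q , p≢q , e) with topEntry-collision r e
    ... | inj₁ dp≡dq = ⊥-elim (p≢q (d-injective dp≡dq))
    ... | inj₂ (inj₁ agrees) = inj₁ (p , q , p≢q , agrees)
    ... | inj₂ (inj₂ agrees) = inj₂ (p , q , p≢q , agrees)

    bottomEntry-extras : ∀ j → Collision (bottomEntry j ∘ d) → AtLeast 2 (Extras j)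
    bottomEntry-extras j (p , q , p≢q , e) with bottomEntry-collision j e
    ... | inj₁ dp≡dq = ⊥-elim (p≢q (d-injective dp≡dq))
    ... | inj₂ (in-p , in-q) = AtLeast-pair p≢q in-p in-q

    Clash⇒AtLeast2 : ∀ {L} {h : Fin κ → Fin L} {a} → Clash h a → AtLeast 2 (Copies a)
    Clash⇒AtLeast2 (p , q , p≢q , agrees) =
      AtLeast-pair p≢q (proj₁ (Agree⇒InCopy agrees)) (proj₂ (Agree⇒InCopy agrees))

    Clashes⇒AtLeast3 : ∀ {a} → Clash row₁ a → Clash row₂ a → AtLeast 3 (Copies a)
    Clashes⇒AtLeast3 {a} (p , q , p≢q , agrees₁) (p′ , q′ , p′≢q′ , agrees₂) =
      AtLeast-two-pairs p≢q p′≢q′ same swapped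
        (proj₁ (Agree⇒InCopy agrees₁)) (proj₂ (Agree⇒InCopy agrees₁))
        (proj₁ (Agree⇒InCopy agrees₂)) (proj₂ (Agree⇒InCopy agrees₂))
      where
      same : ¬ (p′ ≡ p × q′ ≡ q)
      same (refl , refl) = p≢q (d-injective (Agree-both agrees₁ agrees₂))
      swapped : ¬ (p′ ≡ q × q′ ≡ p)
      swapped (refl , refl) = p≢q (d-injective (Agree-both agrees₁ (Agree-sym agrees₂)))

    Copies-disjoint : ∀ {a b} → a ≢ b → Copies a ∩ Copies b ⊆ ∅
    Copies-disjoint a≢b (in-a , in-b) = a≢b (InCopy-unique in-a in-b)

    3+2⇒AtLeast5 : ∀ {a b τ} → a ≢ b → triple a ≡ τ → triple b ≡ τ →
      AtLeast 3 (Copies a) → AtLeast 2 (Copies b) → AtLeast 5 (InTriple τ)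
    3+2⇒AtLeast5 a≢b ta tb A B =
      AtLeast-mono (λ { (inj₁ in-a) → _ , ta , in-a ; (inj₂ in-b) → _ , tb , in-b })
        (AtLeast-∪ (Copies-disjoint a≢b) A B)

    2+2+2⇒AtLeast5 : ∀ {a b c τ} → a ≢ b → a ≢ c → b ≢ c →
      triple a ≡ τ → triple b ≡ τ → triple c ≡ τ →
      AtLeast 2 (Copies a) → AtLeast 2 (Copies b) → AtLeast 2 (Copies c) → AtLeast 5 (InTriple τ)
    2+2+2⇒AtLeast5 a≢b a≢c b≢c ta tb tc A B C =
      AtLeast-≤ (ℕ.n≤1+n 5)
        (AtLeast-mono inTriple (AtLeast-∪ disjoint A (AtLeast-∪ (Copies-disjoint b≢c) B C)))
      where
      disjoint : Copies _ ∩ (Copies _ ∪ Copies _) ⊆ ∅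
      disjoint (in-a , inj₁ in-b) = Copies-disjoint a≢b (in-a , in-b)
      disjoint (in-a , inj₂ in-c) = Copies-disjoint a≢c (in-a , in-c)
      inTriple : Copies _ ∪ (Copies _ ∪ Copies _) ⊆ InTriple _
      inTriple (inj₁ in-a) = _ , ta , in-a
      inTriple (inj₂ (inj₁ in-b)) = _ , tb , in-b
      inTriple (inj₂ (inj₂ in-c)) = _ , tc , in-c

    triple-AtLeast5 : ∀ a₀ a₁ a₂ {τ} → a₀ ≢ a₁ → a₀ ≢ a₂ → a₁ ≢ a₂ →
      triple a₀ ≡ τ → triple a₁ ≡ τ → triple a₂ ≡ τ →
      Clash row₁ a₀ ⊎ Clash row₂ a₂ → Clash row₁ a₁ ⊎ Clash row₂ a₀ → Clash row₁ a₂ ⊎ Clash row₂ a₁ →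
      AtLeast 5 (InTriple τ)
    triple-AtLeast5 _ _ _ n01 n02 n12 t0 t1 t2 (inj₁ c0) (inj₁ c1) (inj₁ c2) =
      2+2+2⇒AtLeast5 n01 n02 n12 t0 t1 t2 (Clash⇒AtLeast2 c0) (Clash⇒AtLeast2 c1) (Clash⇒AtLeast2 c2)
    triple-AtLeast5 _ _ _ n01 n02 n12 t0 t1 t2 (inj₁ c0) (inj₁ c1) (inj₂ c1′) =
      3+2⇒AtLeast5 (n01 ∘ sym) t1 t0 (Clashes⇒AtLeast3 c1 c1′) (Clash⇒AtLeast2 c0)
    triple-AtLeast5 _ _ _ n01 n02 n12 t0 t1 t2 (inj₁ c0) (inj₂ c0′) (inj₁ c2) =
      3+2⇒AtLeast5 n02 t0 t2 (Clashes⇒AtLeast3 c0 c0′) (Clash⇒AtLeast2 c2)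
    triple-AtLeast5 _ _ _ n01 n02 n12 t0 t1 t2 (inj₁ c0) (inj₂ c0′) (inj₂ c1′) =
      3+2⇒AtLeast5 n01 t0 t1 (Clashes⇒AtLeast3 c0 c0′) (Clash⇒AtLeast2 c1′)
    triple-AtLeast5 _ _ _ n01 n02 n12 t0 t1 t2 (inj₂ c2′) (inj₁ c1) (inj₁ c2) =
      3+2⇒AtLeast5 (n12 ∘ sym) t2 t1 (Clashes⇒AtLeast3 c2 c2′) (Clash⇒AtLeast2 c1)
    triple-AtLeast5 _ _ _ n01 n02 n12 t0 t1 t2 (inj₂ c2′) (inj₁ c1) (inj₂ c1′) =
      3+2⇒AtLeast5 n12 t1 t2 (Clashes⇒AtLeast3 c1 c1′) (Clash⇒AtLeast2 c2′)
    triple-AtLeast5 _ _ _ n01 n02 n12 t0 t1 t2 (inj₂ c2′) (inj₂ c0′) (inj₁ c2) =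
      3+2⇒AtLeast5 (n02 ∘ sym) t2 t0 (Clashes⇒AtLeast3 c2 c2′) (Clash⇒AtLeast2 c0′)
    triple-AtLeast5 _ _ _ n01 n02 n12 t0 t1 t2 (inj₂ c2′) (inj₂ c0′) (inj₂ c1′) =
      2+2+2⇒AtLeast5 n01 n02 n12 t0 t1 t2 (Clash⇒AtLeast2 c0′) (Clash⇒AtLeast2 c1′) (Clash⇒AtLeast2 c2′)

    every-row-collides⇒≤ : (∀ r → Collision (entry r ∘ d)) → 10 + m * 2 ≤ t
    every-row-collides⇒≤ collides =
      AtLeast⇒≤ (AtLeast-∪ Triples∩Extras (AtLeast-∪ Triple₀∩Triple₁ low high) extras)
      where
      top : ∀ r → Clash row₁ r ⊎ Clash row₂ (partner r)
      top r = topEntry-clash r (collides (inj₁ r))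
      low : AtLeast 5 (InTriple (# 0))
      low = triple-AtLeast5 (# 0) (# 1) (# 2) (λ ()) (λ ()) (λ ()) refl refl refl
              (top (# 0)) (top (# 1)) (top (# 2))
      high : AtLeast 5 (InTriple (# 1))
      high = triple-AtLeast5 (# 3) (# 4) (# 5) (λ ()) (λ ()) (λ ()) refl refl refl
               (top (# 3)) (top (# 4)) (top (# 5))
      extras : AtLeast (m * 2) (λ p → ∃ λ j → Extras j p)
      extras = AtLeast-⋃ m Extras InExtra-unique λ j → bottomEntry-extras j (collides (inj₂ j))
      Triple₀∩Triple₁ : InTriple (# 0) ∩ InTriple (# 1) ⊆ ∅
      Triple₀∩Triple₁ ((_ , ta , in-a) , (_ , tb , in-b))
        with refl ← InCopy-unique in-a in-b
        with () ← trans (sym ta) tb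
      Triples∩Extras : (InTriple (# 0) ∪ InTriple (# 1)) ∩ (λ p → ∃ λ j → Extras j p) ⊆ ∅
      Triples∩Extras (inj₁ (_ , _ , in-a) , _ , in-j) = InCopy∩InExtra in-a in-j
      Triples∩Extras (inj₂ (_ , _ , in-a) , _ , in-j) = InCopy∩InExtra in-a in-j

  top-encoding : Top ↣ Fin (4 * κ + m * k + L₁ + L₂)
  top-encoding = ((↣-id _ ×ᶠ ↣-id _ ⊎ᶠ ↣-id _ ×ᶠ ↣-id _) ⊎ᶠ ↣-id _) ⊎ᶠ ↣-id _

  bottom-encoding : Bottom ↣ Fin (6 * κ + (ℕ.pred m * k + 1))
  bottom-encoding = ↣-id _ ×ᶠ ↣-id _ ⊎ᶠ ↣-id _ ×ᶠ ↣-id _ ⊎ᶠ ↔⇒↣ (↔-sym 1↔⊤)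

  size : Row → ℕ
  size (inj₁ _) = 4 * κ + m * k + L₁ + L₂
  size (inj₂ _) = 6 * κ + (ℕ.pred m * k + 1)

  encode : ∀ r → Symbol r ↣ Fin (size r)
  encode (inj₁ _) = top-encoding
  encode (inj₂ _) = bottom-encoding

  columns : Fin (6 * κ + m * k) ↣ Col
  columns = (↔⇒↣ *↔× ⊎-↣ ↔⇒↣ *↔×) ↣-∘ ↔⇒↣ +↔⊎

  open Realisation +↔⊎ columns Symbol size encode entry

  topWeight bottomWeight : ℤ
  topWeight = + (4 * κ + m * k + w₁ + w₂)
  bottomWeight = + (6 * κ) ℤ.+ (+ (6 + m) ℤ.- + 7) ℤ.* + k ℤ.+ + 1

  size≤weight : ∀ r → + size r ℤ.≤ [ const topWeight , const bottomWeight ] r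
  size≤weight (inj₁ _) = +≤+ (ℕ.+-mono-≤ (ℕ.+-monoʳ-≤ (4 * κ + m * k) L₁≤w₁) L₂≤w₂)
  size≤weight (inj₂ j) = ℤ.≤-reflexive (bottom-size≡ κ k j)

  array-isHHF : IsHHF (6 + m) (6 * κ + m * k) (expo2 topWeight 6 bottomWeight) array
  array-isHHF i = array-rowAtMost i
    (subst (+ size (splitAt 6 i) ℤ.≤_) (sym (expo2-splitAt 6 i)) (size≤weight (splitAt 6 i)))

  array-isPerfect : IsPerfect (6 + m) (6 * κ + m * k) (2 * (6 + m) ∸ 3) array
  array-isPerfect = array-perfect λ d d-injective collides →
    ℕ.<⇒≱ (2[6+m]∸3<10+m*2 m) (Analysis.every-row-collides⇒≤ d d-injective collides)

  phhf : PHHF (6 + m) (6 * κ + m * k) (expo2 topWeight 6 bottomWeight) (2 * (6 + m) ∸ 3)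
  phhf = array , array-isHHF , array-isPerfect

-- Part (ii)

module Balanced (κ w₁ w₂ m : ℕ) (w₁+w₂≤2κ : w₁ + w₂ ≤ 2 * κ) where
  open ≡-Reasoning

  k K W : ℕ
  k = suc (2 * κ ∸ (w₁ + w₂))
  K = 6 * κ + m * k
  W = 4 * κ + m * k + w₁ + w₂

  kℤ : ℤ
  kℤ = + 2 ℤ.* + κ ℤ.- (+ w₁ ℤ.+ + w₂) ℤ.+ + 1

  k≡ : + k ≡ kℤ
  k≡ = begin
    + suc (2 * κ ∸ (w₁ + w₂))          ≡⟨ cong +_ (ℕ.+-comm 1 _) ⟩
    + (2 * κ ∸ (w₁ + w₂)) ℤ.+ + 1      ≡⟨ cong (ℤ._+ + 1) (ℤ.⊖-≥ w₁+w₂≤2κ) ⟨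
    (2 * κ ℤ.⊖ (w₁ + w₂)) ℤ.+ + 1      ≡⟨ cong (ℤ._+ + 1) (ℤ.m-n≡m⊖n (2 * κ) (w₁ + w₂)) ⟨
    + (2 * κ) ℤ.- + (w₁ + w₂) ℤ.+ + 1  ≡⟨ cong (λ z → z ℤ.- + (w₁ + w₂) ℤ.+ + 1) (ℤ.pos-* 2 κ) ⟩
    kℤ                                 ∎

  times-k : ∀ a → + (a * k) ≡ + a ℤ.* kℤ
  times-k a = trans (ℤ.pos-* a k) (cong (+ a ℤ.*_) k≡)

  K≡ : + K ≡ (+ (2 * (6 + m)) ℤ.- + 6) ℤ.* + κ ℤ.- (+ (6 + m) ℤ.- + 6) ℤ.* (+ (w₁ + w₂) ℤ.- + 1)
  K≡ = trans (cong₂ ℤ._+_ (ℤ.pos-* 6 κ) (times-k m)) (identity (+ κ) (+ m) (+ w₁) (+ w₂))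
    where
    identity : ∀ κ m w₁ w₂ → + 6 ℤ.* κ ℤ.+ m ℤ.* (+ 2 ℤ.* κ ℤ.- (w₁ ℤ.+ w₂) ℤ.+ + 1)
      ≡ (+ 2 ℤ.* (+ 6 ℤ.+ m) ℤ.- + 6) ℤ.* κ ℤ.- ((+ 6 ℤ.+ m) ℤ.- + 6) ℤ.* ((w₁ ℤ.+ w₂) ℤ.- + 1)
    identity = ℤ-Solver.solve-∀

  W-expanded : + W ≡ + 4 ℤ.* + κ ℤ.+ + m ℤ.* kℤ ℤ.+ + w₁ ℤ.+ + w₂
  W-expanded = cong (λ z → z ℤ.+ + w₁ ℤ.+ + w₂) (cong₂ ℤ._+_ (ℤ.pos-* 4 κ) (times-k m))

  W≡ : + W ≡ (+ (2 * (6 + m)) ℤ.- + 8) ℤ.* + κ ℤ.- (+ (6 + m) ℤ.- + 7) ℤ.* (+ (w₁ + w₂) ℤ.- + 1) ℤ.+ + 1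
  W≡ = trans W-expanded (identity (+ κ) (+ m) (+ w₁) (+ w₂))
    where
    identity : ∀ κ m w₁ w₂ → + 4 ℤ.* κ ℤ.+ m ℤ.* (+ 2 ℤ.* κ ℤ.- (w₁ ℤ.+ w₂) ℤ.+ + 1) ℤ.+ w₁ ℤ.+ w₂
      ≡ (+ 2 ℤ.* (+ 6 ℤ.+ m) ℤ.- + 8) ℤ.* κ ℤ.- ((+ 6 ℤ.+ m) ℤ.- + 7) ℤ.* ((w₁ ℤ.+ w₂) ℤ.- + 1) ℤ.+ + 1
    identity = ℤ-Solver.solve-∀

  bottomWeight≡W : + (6 * κ) ℤ.+ (+ (6 + m) ℤ.- + 7) ℤ.* + k ℤ.+ + 1 ≡ + W
  bottomWeight≡W =
    trans (cong₂ (λ a b → a ℤ.+ (+ (6 + m) ℤ.- + 7) ℤ.* b ℤ.+ + 1) (ℤ.pos-* 6 κ) k≡)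
      (trans (identity (+ κ) (+ m) (+ w₁) (+ w₂)) (sym W-expanded))
    where
    identity : ∀ κ m w₁ w₂ →
      + 6 ℤ.* κ ℤ.+ ((+ 6 ℤ.+ m) ℤ.- + 7) ℤ.* (+ 2 ℤ.* κ ℤ.- (w₁ ℤ.+ w₂) ℤ.+ + 1) ℤ.+ + 1
      ≡ + 4 ℤ.* κ ℤ.+ m ℤ.* (+ 2 ℤ.* κ ℤ.- (w₁ ℤ.+ w₂) ℤ.+ + 1) ℤ.+ w₁ ℤ.+ w₂
    identity = ℤ-Solver.solve-∀

lemma21 : (κ w₁ w₂ n : ℕ) →
    PHHF 2 κ (pair (+ w₁) (+ w₂)) 2 →
    6 ≤ n →
    ((k : ℕ) → 1 ≤ k →
      PHHF n (6 * κ + (n ∸ 6) * k)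
        (expo2 (+ (4 * κ + (n ∸ 6) * k + w₁ + w₂)) 6
               (+ (6 * κ) ℤ.+ (+ n ℤ.- + 7) ℤ.* + k ℤ.+ + 1))
        (2 * n ∸ 3))
    ×
    (w₁ + w₂ ≤ 2 * κ →
      ∃ λ (K : ℕ) → ∃ λ (W : ℕ) →
        (+ K ≡ (+ (2 * n) ℤ.- + 6) ℤ.* + κ ℤ.- (+ n ℤ.- + 6) ℤ.* (+ (w₁ + w₂) ℤ.- + 1))
        × (+ W ≡ (+ (2 * n) ℤ.- + 8) ℤ.* + κ ℤ.- (+ n ℤ.- + 7) ℤ.* (+ (w₁ + w₂) ℤ.- + 1) ℤ.+ + 1)
        × PHF n K (+ W) (2 * n ∸ 3))
-- The construction works for every k.
lemma21 κ w₁ w₂ _ base (s≤s (s≤s (s≤s (s≤s (s≤s (s≤s (z≤n {m}))))))) =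
    (λ k _ → Construction.phhf code k m)
  , λ w₁+w₂≤2κ → let open Balanced κ w₁ w₂ m w₁+w₂≤2κ in
      K , W , K≡ , W≡ ,
      PHHF-weaken (expo2-≤ {u = 6} ℤ.≤-refl (ℤ.≤-reflexive bottomWeight≡W)) (Construction.phhf code k m)
  where
  code : TwoRowCode κ w₁ w₂
  code = phhf⇒twoRowCode base
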